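{- Let $q$ be a prime power, let $\ell$ be a line of $\mathrm{PG}(2,q)$ and let $P\in\ell$. Let $\mathcal{X}_{P,\ell}$ be the set of all minimal blocking sets $\mathcal{B}$ of $\mathrm{PG}(2,q)$ containing $P$ that have the $r_\infty$-property with respect to $P$ with $\ell$ being the unique tangent to $\mathcal{B}$ through $P$, and let $\mathcal{Y}_{\Pi_P}$ be the set of all minimal blocking sets of $\mathrm{AG}(2,q)=\mathrm{PG}(2,q)\setminus\ell$ having the $\Pi$-property with respect to the direction $\Pi_P$. Then the map $\alpha:\mathcal{X}_{P,\ell}\to\mathcal{Y}_{\Pi_P}$, $\alpha(\mathcal{B})=\mathcal{B}\setminus\{P\}$, is well defined and is a bijection.
   Context: A blocking set of $\mathrm{PG}(2,q)$ is a set of points meeting every line and containing no line; minimal if no proper subset is a blocking set. A line is tangent to a point set $\mathcal{K}$ if it meets $\mathcal{K}$ in exactly one point, secant if in more than one. $\mathcal{B}$ has the $r_\infty$-property with respect to $P\in\mathcal{B}$ if exactly one line through $P$ is tangent to $\mathcal{B}$ and all other lines through $P$ are secants. $\mathrm{AG}(2,q)=\mathrm{PG}(2,q)\setminus\ell$ is the affine plane whose points are the points not on $\ell$ and whose lines are the lines other than $\ell$, with induced incidence. A blocking set of $\mathrm{AG}(2,q)$ is a set of points meeting every affine line (it may contain lines); minimal if no proper subset is. For $P\in\ell$, the direction (parallel class) $\Pi_P$ is the set of affine lines whose projective closure passes through $P$. An affine blocking set $\mathcal{B}$ has the $\Pi$-property with respect to a direction $\Pi$ if: (j) through every point $Q\in\mathcal{B}$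 there is an affine line $m\notin\Pi$ tangent to $\mathcal{B}$; and (jj) no line of $\Pi$ is contained in $\mathcal{B}$. -}

module Defs where

open import Level using (0ℓ)
open import Data.Nat using (ℕ; suc; _^_)
open import Data.Nat.Primality using (Prime)
open import Data.Fin using (Fin)
open import Data.Bool using (Bool; true; false; _∧_; not)
open import Data.Product using (Σ; ∃; ∃-syntax; _×_; _,_)
open import Relation.Nullary using (¬_; Dec; does; yes; no)
open import Relation.Binary.PropositionalEquality using (_≡_; _≢_; refl)
open import Relation.Binary.Definitions using (DecidableEquality)
open import Algebra.Structures using (IsCommutativeRing)
open import Function.Bundles using (_↔_)

IsPrimePower : ℕ → Set
IsPrimePower q = ∃[ p ] ∃[ n ] (Prime p × q ≡ p ^ suc n)

record FiniteField (q : ℕ) : Set₁ where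
  field
    Carrier : Set
    _+_ _*_ : Carrier → Carrier → Carrier
    -_      : Carrier → Carrier
    0# 1#   : Carrier
    isCommutativeRing : IsCommutativeRing _≡_ _+_ _*_ -_ 0# 1#
    0≢1     : 0# ≢ 1#
    _⁻¹     : Carrier → Carrier
    ⁻¹-inverse : ∀ x → x ≢ 0# → x * (x ⁻¹) ≡ 1#
    _≟_     : DecidableEquality Carrier
    enum    : Carrier ↔ Fin q

-- The projective plane PG(2,F) over a field F, with homogeneous coordinates
-- in normalised form: (1,y,z), (0,1,z), (0,0,1).
module PG {q : ℕ} (𝔽 : FiniteField q) where
  open FiniteField 𝔽

  data Point : Set where
    pt1 : Carrier → Carrier → Point
    pt2 : Carrier → Point
    pt3 : Point

  -- lines are given by (normalised) dual coordinates [a : b : c]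
  Line : Set
  Line = Point

  coords : Point → Carrier × Carrier × Carrier
  coords (pt1 y z) = 1# , y , z
  coords (pt2 z)   = 0# , 1# , z
  coords pt3       = 0# , 0# , 1#

  _on_ : Point → Line → Set
  P on m with coords P | coords m
  ... | (x , y , z) | (a , b , c) = ((a * x) + (b * y)) + (c * z) ≡ 0#

  PointSet : Set
  PointSet = Point → Bool

  _∈_ : Point → PointSet → Set
  P ∈ B = B P ≡ true

  _⊆_ : PointSet → PointSet → Set
  A ⊆ B = ∀ P → P ∈ A → P ∈ B

  _⊂_ : PointSet → PointSet → Set
  A ⊂ B = A ⊆ B × ∃[ P ] (P ∈ B × ¬ (P ∈ A))

  _≐_ : PointSet → PointSet → Set
  A ≐ B = ∀ P → A P ≡ B P

  _≟P_ : DecidableEquality Point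
  pt1 y z ≟P pt1 y' z' with y ≟ y' | z ≟ z'
  ... | yes refl | yes refl = yes refl
  ... | no y≢y'  | _        = no λ { refl → y≢y' refl }
  ... | yes _    | no z≢z'  = no λ { refl → z≢z' refl }
  pt1 _ _ ≟P pt2 _ = no λ ()
  pt1 _ _ ≟P pt3   = no λ ()
  pt2 _ ≟P pt1 _ _ = no λ ()
  pt2 z ≟P pt2 z' with z ≟ z'
  ... | yes refl = yes refl
  ... | no z≢z'  = no λ { refl → z≢z' refl }
  pt2 _ ≟P pt3     = no λ ()
  pt3 ≟P pt1 _ _   = no λ ()
  pt3 ≟P pt2 _     = no λ ()
  pt3 ≟P pt3       = yes refl

  _∖｛_｝ : PointSet → Point → PointSet
  (B ∖｛ P ｝) Q = B Q ∧ not (does (Q ≟P P))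

  Tangent : PointSet → Line → Set
  Tangent B m = ∃[ Q ] ((Q ∈ B × Q on m) × (∀ R → R ∈ B → R on m → R ≡ Q))

  Secant : PointSet → Line → Set
  Secant B m = ∃[ Q ] ∃[ R ] ((Q ∈ B × Q on m) × (R ∈ B × R on m) × Q ≢ R)

  ContainsLine : PointSet → Line → Set
  ContainsLine B m = ∀ Q → Q on m → Q ∈ B

  IsBlockingSet : PointSet → Set
  IsBlockingSet B = (∀ m → ∃[ Q ] (Q ∈ B × Q on m)) × (∀ m → ¬ ContainsLine B m)

  IsMinimalBlockingSet : PointSet → Set
  IsMinimalBlockingSet B = IsBlockingSet B × (∀ B' → B' ⊂ B → ¬ IsBlockingSet B')

  rInfProperty : PointSet → Point → Line → Set
  rInfProperty B P ℓ = P on ℓ × Tangent B ℓ × (∀ m → P on m → m ≢ ℓ → Secant B m)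

  InX : Point → Line → PointSet → Set
  InX P ℓ B = IsMinimalBlockingSet B × P ∈ B × rInfProperty B P ℓ

  -- Affine notions in AG(2,q) = PG(2,q) ∖ ℓ.
  -- Affine points are the points not on ℓ, affine lines are the lines ≢ ℓ;
  -- an affine point set is a point set all of whose points are off ℓ.

  IsAffineSet : Line → PointSet → Set
  IsAffineSet ℓ B = ∀ Q → Q ∈ B → ¬ (Q on ℓ)

  AffContainsLine : Line → PointSet → Line → Set
  AffContainsLine ℓ B m = ∀ Q → Q on m → ¬ (Q on ℓ) → Q ∈ B

  IsAffBlockingSet : Line → PointSet → Set
  IsAffBlockingSet ℓ B = IsAffineSet ℓ B × (∀ m → m ≢ ℓ → ∃[ Q ] (Q ∈ B × Q on m × ¬ (Q on ℓ)))

  IsMinimalAffBlockingSet : Line → PointSet → Set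
  IsMinimalAffBlockingSet ℓ B =
    IsAffBlockingSet ℓ B × (∀ B' → B' ⊂ B → ¬ IsAffBlockingSet ℓ B')

  -- Π-property w.r.t. the direction Π_P (P ∈ ℓ): Π_P is the set of affine
  -- lines m ≢ ℓ with P on m.
  PiProperty : Line → Point → PointSet → Set
  PiProperty ℓ P B =
    -- (j) through every Q ∈ B there is an affine line m ∉ Π_P tangent to B
    (∀ Q → Q ∈ B → ∃[ m ] (m ≢ ℓ × ¬ (P on m) × Q on m × Tangent B m))
    -- (jj) no line of Π_P is contained in B
    × (∀ m → m ≢ ℓ → P on m → ¬ AffContainsLine ℓ B m)

  InY : Line → Point → PointSet → Set
  InY ℓ P B = IsMinimalAffBlockingSet ℓ B × PiProperty ℓ P B

{-# OPTIONS --safe #-}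
module Submission where

-- The inverse of B ↦ B ∖ {P} is A ↦ A ∪ {P}, and every condition is read off at tangents.
-- If ℓ is the only tangent through P then B ∩ ℓ = {P}, so B ∖ {P} is affine, and it meets the
-- lines through P other than ℓ precisely because they are secants of B.  A set meeting every line
-- of a family is irredundant as soon as each of its points lies on a tangent from that family, and
-- a minimal blocking set has a tangent at each point.  At P this tangent is ℓ; at Q ≠ P it is an
-- affine line avoiding P (a line through P other than ℓ is a secant), which is condition (j).
-- A line other than ℓ that avoids P meets ℓ in a point of B ∩ ℓ = {P}, which is absurd, so a line
-- contained in A ∪ {P} passes through P, and (jj) rules those out.  The incidence facts used (two
-- distinct lines meet in exactly one point) come from cross products in 𝔽³, and finiteness of 𝔽
-- makes the search for a tangent constructive.

open import Defs
open import Data.Nat using (ℕ)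
open import Data.Product using (∃; ∃-syntax; _×_; _,_; proj₁; proj₂)

open import Level using (0ℓ)
import Data.Nat as ℕ
import Data.Nat.Properties as ℕ
open import Data.Integer as ℤ using (ℤ; +_; -[1+_]; _⊖_; _◃_)
import Data.Integer.Properties as ℤ
open import Data.Sign as Sign using (Sign)
open import Data.Bool as Bool using (true; _∨_)
open import Data.Bool.Properties using (∧-identityʳ; ∧-zeroʳ; ∨-identityʳ; ∨-zeroʳ; ¬-not)
open import Data.Maybe using (Maybe; map)
open import Data.Fin.Properties using (any?)
open import Data.Sum using (_⊎_; inj₁; inj₂)
open import Data.Empty using (⊥-elim)
open import Data.Unit using (⊤; tt)
open import Function using (_∘_)
open import Function.Bundles using (Inverse)
open import Relation.Nullary using (¬_; Dec; yes; no; does)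
open import Relation.Nullary.Decidable using (map′; ¬?; _×-dec_; _⊎-dec_; decidable-stable)
open import Relation.Unary using (Decidable)
open import Relation.Binary.Consequences using (dec⇒weaklyDec)
open import Relation.Binary.PropositionalEquality as ≡ using (_≡_; _≢_)
open import Algebra.Bundles using (CommutativeRing)
open import Algebra.Solver.Ring.AlmostCommutativeRing using (_-Raw-AlmostCommutative⟶_; fromCommutativeRing)

-- A ring solver for any commutative ring with coefficients in ℤ: cancelling coefficients (1 - 1 = 0)
-- then happens by computation, which is stuck when the ring's own elements serve as coefficients.
module IntegerCoefficients {c ℓ} (R : CommutativeRing c ℓ) where
  open CommutativeRing R
  open import Algebra.Properties.Ring ring using (-0#≈0#; -‿involutive; -1*x≈-x; -‿+-comm)
  open import Algebra.Properties.CommutativeSemigroup +-commutativeSemigroup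
    using (interchange)
  open import Algebra.Properties.CommutativeSemigroup *-commutativeSemigroup
    using () renaming (interchange to *-interchange)
  open import Algebra.Properties.Semiring.Mult semiring using (×-homo-+; ×1-homo-*)
    renaming (_×_ to _·_)
  open import Relation.Binary.Reasoning.Setoid setoid

  ⟦_⟧ℤ : ℤ → Carrier
  ⟦ + n ⟧ℤ      = n · 1#
  ⟦ -[1+ n ] ⟧ℤ = - (ℕ.suc n · 1#)

  ⟦_⟧ₛ : Sign → Carrier
  ⟦ Sign.+ ⟧ₛ = 1#
  ⟦ Sign.- ⟧ₛ = - 1#

  ⊖-homo : ∀ m n → ⟦ m ⊖ n ⟧ℤ ≈ m · 1# - n · 1#
  ⊖-homo m       ℕ.zero    = sym (trans (+-congˡ -0#≈0#) (+-identityʳ _))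
  ⊖-homo ℕ.zero  (ℕ.suc n) = sym (+-identityˡ _)
  ⊖-homo (ℕ.suc m) (ℕ.suc n) = begin
    ⟦ ℕ.suc m ⊖ ℕ.suc n ⟧ℤ          ≡⟨ ≡.cong ⟦_⟧ℤ (ℤ.[1+m]⊖[1+n]≡m⊖n m n) ⟩
    ⟦ m ⊖ n ⟧ℤ                      ≈⟨ ⊖-homo m n ⟩
    m · 1# - n · 1#                 ≈⟨ +-identityˡ _ ⟨
    0# + (m · 1# - n · 1#)          ≈⟨ +-congʳ (-‿inverseʳ 1#) ⟨
    (1# - 1#) + (m · 1# - n · 1#)   ≈⟨ interchange _ _ _ _ ⟩
    (1# + m · 1#) + (- 1# - n · 1#) ≈⟨ +-congˡ (-‿+-comm 1# _) ⟩
    (1# + m · 1#) - (1# + n · 1#)   ∎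

  +-homo : ∀ i j → ⟦ i ℤ.+ j ⟧ℤ ≈ ⟦ i ⟧ℤ + ⟦ j ⟧ℤ
  +-homo (+ m)    (+ n)    = ×-homo-+ 1# m n
  +-homo (+ m)    -[1+ n ] = ⊖-homo m (ℕ.suc n)
  +-homo -[1+ m ] (+ n)    = trans (⊖-homo n (ℕ.suc m)) (+-comm _ _)
  +-homo -[1+ m ] -[1+ n ] = begin
    - (ℕ.suc (ℕ.suc (m ℕ.+ n)) · 1#)        ≡⟨ ≡.cong (λ k → - (ℕ.suc k · 1#)) (ℕ.+-suc m n) ⟨
    - ((ℕ.suc m ℕ.+ ℕ.suc n) · 1#)          ≈⟨ -‿cong (×-homo-+ 1# (ℕ.suc m) (ℕ.suc n)) ⟩
    - (ℕ.suc m · 1# + ℕ.suc n · 1#)         ≈⟨ -‿+-comm _ _ ⟨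
    - (ℕ.suc m · 1#) + - (ℕ.suc n · 1#)     ∎

  ◃-homo : ∀ s n → ⟦ s ◃ n ⟧ℤ ≈ ⟦ s ⟧ₛ * (n · 1#)
  ◃-homo s      ℕ.zero    = sym (zeroʳ _)
  ◃-homo Sign.+ (ℕ.suc n) = sym (*-identityˡ _)
  ◃-homo Sign.- (ℕ.suc n) = sym (-1*x≈-x _)

  sign-homo : ∀ s t → ⟦ s Sign.* t ⟧ₛ ≈ ⟦ s ⟧ₛ * ⟦ t ⟧ₛ
  sign-homo Sign.+ t      = sym (*-identityˡ _)
  sign-homo Sign.- Sign.+ = sym (*-identityʳ _)
  sign-homo Sign.- Sign.- = sym (trans (-1*x≈-x (- 1#)) (-‿involutive 1#))

  ⟦⟧-sign-abs : ∀ i → ⟦ i ⟧ℤ ≈ ⟦ ℤ.sign i ⟧ₛ * (ℤ.∣ i ∣ · 1#)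
  ⟦⟧-sign-abs i = trans (reflexive (≡.cong ⟦_⟧ℤ (≡.sym (ℤ.◃-inverse i)))) (◃-homo (ℤ.sign i) ℤ.∣ i ∣)

  *-homo : ∀ i j → ⟦ i ℤ.* j ⟧ℤ ≈ ⟦ i ⟧ℤ * ⟦ j ⟧ℤ
  *-homo i j = begin
    ⟦ (s Sign.* t) ◃ (m ℕ.* n) ⟧ℤ              ≈⟨ ◃-homo (s Sign.* t) (m ℕ.* n) ⟩
    ⟦ s Sign.* t ⟧ₛ * ((m ℕ.* n) · 1#)         ≈⟨ *-cong (sign-homo s t) (×1-homo-* m n) ⟩
    (⟦ s ⟧ₛ * ⟦ t ⟧ₛ) * ((m · 1#) * (n · 1#))  ≈⟨ *-interchange _ _ _ _ ⟩
    (⟦ s ⟧ₛ * (m · 1#)) * (⟦ t ⟧ₛ * (n · 1#))  ≈⟨ *-cong (⟦⟧-sign-abs i) (⟦⟧-sign-abs j) ⟨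
    ⟦ i ⟧ℤ * ⟦ j ⟧ℤ                            ∎
    where s = ℤ.sign i; t = ℤ.sign j; m = ℤ.∣ i ∣; n = ℤ.∣ j ∣

  -‿homo : ∀ i → ⟦ ℤ.- i ⟧ℤ ≈ - ⟦ i ⟧ℤ
  -‿homo (+ ℕ.zero)  = sym -0#≈0#
  -‿homo (+ ℕ.suc n) = refl
  -‿homo -[1+ n ]    = sym (-‿involutive _)

  ℤ-morphism : ℤ.+-*-rawRing -Raw-AlmostCommutative⟶ fromCommutativeRing R
  ℤ-morphism = record
    { ⟦_⟧ = ⟦_⟧ℤ ; +-homo = +-homo ; *-homo = *-homo ; -‿homo = -‿homo
    ; 0-homo = refl ; 1-homo = +-identityʳ 1# }

  coefficient-≟ : ∀ i j → Maybe (⟦ i ⟧ℤ ≈ ⟦ j ⟧ℤ)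
  coefficient-≟ i j = map (reflexive ∘ ≡.cong ⟦_⟧ℤ) (dec⇒weaklyDec ℤ._≟_ i j)

  open import Algebra.Solver.Ring ℤ.+-*-rawRing (fromCommutativeRing R) ℤ-morphism coefficient-≟ public

module PlaneGeometry {q : ℕ} (𝔽 : FiniteField q) where
  open FiniteField 𝔽 using (Carrier; isCommutativeRing; _⁻¹; ⁻¹-inverse; 0≢1; _≟_; enum)
  module Enum = Inverse enum
  open ≡ using (refl; sym; trans; cong; cong₂; subst)
  open ≡.≡-Reasoning

  commutativeRing : CommutativeRing 0ℓ 0ℓ
  commutativeRing = record { isCommutativeRing = isCommutativeRing }

  open CommutativeRing commutativeRing
    using (_+_; _*_; -_; _-_; 0#; 1#; ring; *-identityˡ; *-identityʳ; zeroˡ; zeroʳ; -‿inverseʳ)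
  open import Algebra.Properties.Ring ring using (x∙y⁻¹≈ε⇒x≈y)
  open IntegerCoefficients commutativeRing using (solve; _:=_; _:+_; _:*_; _:-_; con)

  1*1≢0 : 1# * 1# ≢ 0#
  1*1≢0 1*1≡0 = 0≢1 (sym (trans (sym (*-identityˡ 1#)) 1*1≡0))

  *1≡1*⇒≡ : ∀ {a b} → a * 1# ≡ 1# * b → a ≡ b
  *1≡1*⇒≡ {a} {b} e = trans (sym (*-identityʳ a)) (trans e (*-identityˡ b))

  0≡*ˡ : ∀ {a c} → a ≡ 0# → 0# ≡ a * c
  0≡*ˡ {a} {c} a≡0 = sym (trans (cong (_* c) a≡0) (zeroˡ c))

  F³ : Set
  F³ = Carrier × Carrier × Carrier

  0ᵥ : F³
  0ᵥ = 0# , 0# , 0#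

  _·ᵥ_ : F³ → Carrier → F³
  (x , y , z) ·ᵥ c = x * c , y * c , z * c

  _-ᵥ_ : F³ → F³ → F³
  (x , y , z) -ᵥ (x′ , y′ , z′) = x - x′ , y - y′ , z - z′

  dot : F³ → F³ → Carrier
  dot (a , b , c) (x , y , z) = ((a * x) + (b * y)) + (c * z)

  cross : F³ → F³ → F³
  cross (u₁ , u₂ , u₃) (v₁ , v₂ , v₃) =
    u₂ * v₃ - u₃ * v₂ , u₃ * v₁ - u₁ * v₃ , u₁ * v₂ - u₂ * v₁

  Proportional : F³ → F³ → Set
  Proportional (u₁ , u₂ , u₃) (v₁ , v₂ , v₃) =
    u₂ * v₃ ≡ u₃ * v₂ × u₃ * v₁ ≡ u₁ * v₃ × u₁ * v₂ ≡ u₂ * v₁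

  triple-≡ : ∀ {x y z x′ y′ z′ : Carrier} → x ≡ x′ → y ≡ y′ → z ≡ z′ → (x , y , z) ≡ (x′ , y′ , z′)
  triple-≡ x≡ y≡ z≡ = cong₂ _,_ x≡ (cong₂ _,_ y≡ z≡)

  cross≡0⇒proportional : ∀ u v → cross u v ≡ 0ᵥ → Proportional u v
  cross≡0⇒proportional u v u×v≡0 =
    x∙y⁻¹≈ε⇒x≈y _ _ (cong proj₁ u×v≡0) ,
    x∙y⁻¹≈ε⇒x≈y _ _ (cong (proj₁ ∘ proj₂) u×v≡0) ,
    x∙y⁻¹≈ε⇒x≈y _ _ (cong (proj₂ ∘ proj₂) u×v≡0)

  dot-cross-selfˡ : ∀ u v → dot u (cross u v) ≡ 0#
  dot-cross-selfˡ (u₁ , u₂ , u₃) (v₁ , v₂ , v₃) = solve 6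
    (λ u₁ u₂ u₃ v₁ v₂ v₃ →
      u₁ :* (u₂ :* v₃ :- u₃ :* v₂) :+ u₂ :* (u₃ :* v₁ :- u₁ :* v₃) :+ u₃ :* (u₁ :* v₂ :- u₂ :* v₁)
      := con (+ 0))
    refl u₁ u₂ u₃ v₁ v₂ v₃

  dot-cross-selfʳ : ∀ u v → dot v (cross u v) ≡ 0#
  dot-cross-selfʳ (u₁ , u₂ , u₃) (v₁ , v₂ , v₃) = solve 6
    (λ u₁ u₂ u₃ v₁ v₂ v₃ →
      v₁ :* (u₂ :* v₃ :- u₃ :* v₂) :+ v₂ :* (u₃ :* v₁ :- u₁ :* v₃) :+ v₃ :* (u₁ :* v₂ :- u₂ :* v₁)
      := con (+ 0))
    refl u₁ u₂ u₃ v₁ v₂ v₃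

  dot-·ᵥ : ∀ u v c → dot u (v ·ᵥ c) ≡ dot u v * c
  dot-·ᵥ (u₁ , u₂ , u₃) (v₁ , v₂ , v₃) c = solve 7
    (λ u₁ u₂ u₃ v₁ v₂ v₃ c →
      u₁ :* (v₁ :* c) :+ u₂ :* (v₂ :* c) :+ u₃ :* (v₃ :* c) := (u₁ :* v₁ :+ u₂ :* v₂ :+ u₃ :* v₃) :* c)
    refl u₁ u₂ u₃ v₁ v₂ v₃ c

  cross-·ᵥ : ∀ u v c → cross u (v ·ᵥ c) ≡ cross u v ·ᵥ c
  cross-·ᵥ (u₁ , u₂ , u₃) (v₁ , v₂ , v₃) c =
    triple-≡ (scaled-difference u₂ u₃ v₃ v₂ c)
             (scaled-difference u₃ u₁ v₁ v₃ c)
             (scaled-difference u₁ u₂ v₂ v₁ c)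
    where
    scaled-difference : ∀ a b x y c → a * (x * c) - b * (y * c) ≡ (a * x - b * y) * c
    scaled-difference =
      solve 5 (λ a b x y c → a :* (x :* c) :- b :* (y :* c) := (a :* x :- b :* y) :* c) refl

  cross-cross : ∀ u p q → cross u (cross p q) ≡ (p ·ᵥ dot u q) -ᵥ (q ·ᵥ dot u p)
  cross-cross (u₁ , u₂ , u₃) (p₁ , p₂ , p₃) (q₁ , q₂ , q₃) = triple-≡
    (solve 9 (λ u₁ u₂ u₃ p₁ p₂ p₃ q₁ q₂ q₃ →
      u₂ :* (p₁ :* q₂ :- p₂ :* q₁) :- u₃ :* (p₃ :* q₁ :- p₁ :* q₃)
      := p₁ :* (u₁ :* q₁ :+ u₂ :* q₂ :+ u₃ :* q₃) :- q₁ :* (u₁ :* p₁ :+ u₂ :* p₂ :+ u₃ :* p₃))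
      refl u₁ u₂ u₃ p₁ p₂ p₃ q₁ q₂ q₃)
    (solve 9 (λ u₁ u₂ u₃ p₁ p₂ p₃ q₁ q₂ q₃ →
      u₃ :* (p₂ :* q₃ :- p₃ :* q₂) :- u₁ :* (p₁ :* q₂ :- p₂ :* q₁)
      := p₂ :* (u₁ :* q₁ :+ u₂ :* q₂ :+ u₃ :* q₃) :- q₂ :* (u₁ :* p₁ :+ u₂ :* p₂ :+ u₃ :* p₃))
      refl u₁ u₂ u₃ p₁ p₂ p₃ q₁ q₂ q₃)
    (solve 9 (λ u₁ u₂ u₃ p₁ p₂ p₃ q₁ q₂ q₃ →
      u₁ :* (p₃ :* q₁ :- p₁ :* q₃) :- u₂ :* (p₂ :* q₃ :- p₃ :* q₂)
      := p₃ :* (u₁ :* q₁ :+ u₂ :* q₂ :+ u₃ :* q₃) :- q₃ :* (u₁ :* p₁ :+ u₂ :* p₂ :+ u₃ :* p₃))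
      refl u₁ u₂ u₃ p₁ p₂ p₃ q₁ q₂ q₃)

  ·ᵥ-zeroˡ : ∀ c → 0ᵥ ·ᵥ c ≡ 0ᵥ
  ·ᵥ-zeroˡ c = triple-≡ (zeroˡ c) (zeroˡ c) (zeroˡ c)

  ·ᵥ-zeroʳ : ∀ v → v ·ᵥ 0# ≡ 0ᵥ
  ·ᵥ-zeroʳ (x , y , z) = triple-≡ (zeroʳ x) (zeroʳ y) (zeroʳ z)

  dot≡0-·ᵥ : ∀ u v c → dot u v ≡ 0# → dot u (v ·ᵥ c) ≡ 0#
  dot≡0-·ᵥ u v c u·v≡0 = begin
    dot u (v ·ᵥ c)  ≡⟨ dot-·ᵥ u v c ⟩
    dot u v * c     ≡⟨ cong (_* c) u·v≡0 ⟩
    0# * c          ≡⟨ zeroˡ c ⟩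
    0#              ∎

  cross≡0-·ᵥ : ∀ u v c → cross u v ≡ 0ᵥ → cross u (v ·ᵥ c) ≡ 0ᵥ
  cross≡0-·ᵥ u v c u×v≡0 = begin
    cross u (v ·ᵥ c)  ≡⟨ cross-·ᵥ u v c ⟩
    cross u v ·ᵥ c    ≡⟨ cong (_·ᵥ c) u×v≡0 ⟩
    0ᵥ ·ᵥ c           ≡⟨ ·ᵥ-zeroˡ c ⟩
    0ᵥ                ∎

  orthogonal⇒cross-cross≡0 : ∀ u p q → dot u p ≡ 0# → dot u q ≡ 0# → cross u (cross p q) ≡ 0ᵥ
  orthogonal⇒cross-cross≡0 u p q u·p≡0 u·q≡0 = begin
    cross u (cross p q)               ≡⟨ cross-cross u p q ⟩
    (p ·ᵥ dot u q) -ᵥ (q ·ᵥ dot u p)  ≡⟨ cong₂ (λ s t → (p ·ᵥ s) -ᵥ (q ·ᵥ t)) u·q≡0 u·p≡0 ⟩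
    (p ·ᵥ 0#) -ᵥ (q ·ᵥ 0#)            ≡⟨ cong₂ _-ᵥ_ (·ᵥ-zeroʳ p) (·ᵥ-zeroʳ q) ⟩
    0ᵥ -ᵥ 0ᵥ                          ≡⟨ triple-≡ (-‿inverseʳ 0#) (-‿inverseʳ 0#) (-‿inverseʳ 0#) ⟩
    0ᵥ                                ∎

  open PG 𝔽

  -- Since Line = Point, P on m unfolds to dot (coords m) (coords P) ≡ 0#.

  proportional-coords⇒≡ : ∀ P Q → Proportional (coords P) (coords Q) → P ≡ Q
  proportional-coords⇒≡ (pt1 y z) (pt1 y′ z′) (_ , z≡ , y≡) = cong₂ pt1 (*1≡1*⇒≡ (sym y≡)) (*1≡1*⇒≡ z≡)
  proportional-coords⇒≡ (pt2 z)   (pt2 z′)    (z≡ , _ , _) = cong pt2 (*1≡1*⇒≡ (sym z≡))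
  proportional-coords⇒≡ pt3       pt3         _            = refl
  proportional-coords⇒≡ (pt1 y z) (pt2 _)     (_ , _ , e)  = ⊥-elim (1*1≢0 (trans e (zeroʳ y)))
  proportional-coords⇒≡ (pt1 y z) pt3         (_ , e , _)  = ⊥-elim (1*1≢0 (trans (sym e) (zeroʳ z)))
  proportional-coords⇒≡ (pt2 z)   (pt1 y′ _)  (_ , _ , e)  = ⊥-elim (1*1≢0 (trans (sym e) (zeroˡ y′)))
  proportional-coords⇒≡ (pt2 z)   pt3         (e , _ , _)  = ⊥-elim (1*1≢0 (trans e (zeroʳ z)))
  proportional-coords⇒≡ pt3       (pt1 _ z′)  (_ , e , _)  = ⊥-elim (1*1≢0 (trans e (zeroˡ z′)))
  proportional-coords⇒≡ pt3       (pt2 z′)    (e , _ , _)  = ⊥-elim (1*1≢0 (trans (sym e) (zeroˡ z′)))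

  cross-coords≡0⇒≡ : ∀ P Q → cross (coords P) (coords Q) ≡ 0ᵥ → P ≡ Q
  cross-coords≡0⇒≡ P Q = proportional-coords⇒≡ P Q ∘ cross≡0⇒proportional (coords P) (coords Q)

  normalise : ∀ w → w ≢ 0ᵥ → ∃[ R ] ∃[ c ] coords R ≡ w ·ᵥ c
  normalise (w₁ , w₂ , w₃) w≢0 with w₁ ≟ 0# | w₂ ≟ 0# | w₃ ≟ 0#
  ... | no w₁≢0 | _ | _ =
    pt1 (w₂ * w₁ ⁻¹) (w₃ * w₁ ⁻¹) , w₁ ⁻¹ , triple-≡ (sym (⁻¹-inverse w₁ w₁≢0)) refl refl
  ... | yes w₁≡0 | no w₂≢0 | _ =
    pt2 (w₃ * w₂ ⁻¹) , w₂ ⁻¹ , triple-≡ (0≡*ˡ w₁≡0) (sym (⁻¹-inverse w₂ w₂≢0)) refl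
  ... | yes w₁≡0 | yes w₂≡0 | no w₃≢0 =
    pt3 , w₃ ⁻¹ , triple-≡ (0≡*ˡ w₁≡0) (0≡*ˡ w₂≡0) (sym (⁻¹-inverse w₃ w₃≢0))
  ... | yes w₁≡0 | yes w₂≡0 | yes w₃≡0 = ⊥-elim (w≢0 (triple-≡ w₁≡0 w₂≡0 w₃≡0))

  -- Every line through P and Q has coordinates proportional to the nonzero vector P × Q.
  joining-line : ∀ {P Q} → P ≢ Q → ∃[ n ] ∀ m → P on m → Q on m → m ≡ n
  joining-line {P} {Q} P≢Q = through (normalise w (P≢Q ∘ cross-coords≡0⇒≡ P Q))
    where
    w : F³
    w = cross (coords P) (coords Q)
    through : ∃[ n ] ∃[ c ] coords n ≡ w ·ᵥ c → ∃[ n ] ∀ m → P on m → Q on m → m ≡ n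
    through (n , c , n≡w·c) = n , λ m P∈m Q∈m → cross-coords≡0⇒≡ m n (begin
      cross (coords m) (coords n)  ≡⟨ cong (cross (coords m)) n≡w·c ⟩
      cross (coords m) (w ·ᵥ c)    ≡⟨ cross≡0-·ᵥ (coords m) w c
                                        (orthogonal⇒cross-cross≡0 (coords m) (coords P) (coords Q) P∈m Q∈m) ⟩
      0ᵥ                           ∎)

  lines-meet-at-most-once : ∀ {ℓ m P Q} → ℓ ≢ m → P on ℓ → P on m → Q on ℓ → Q on m → P ≡ Q
  lines-meet-at-most-once {ℓ} {m} {P} {Q} ℓ≢m P∈ℓ P∈m Q∈ℓ Q∈m with P ≟P Q
  ... | yes P≡Q = P≡Q
  ... | no P≢Q  = let (n , unique) = joining-line P≢Q
                  in ⊥-elim (ℓ≢m (trans (unique ℓ P∈ℓ Q∈ℓ) (sym (unique m P∈m Q∈m))))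

  distinct-lines-meet : ∀ {ℓ m} → ℓ ≢ m → ∃[ R ] (R on ℓ × R on m)
  distinct-lines-meet {ℓ} {m} ℓ≢m = meet (normalise w (ℓ≢m ∘ cross-coords≡0⇒≡ ℓ m))
    where
    w : F³
    w = cross (coords ℓ) (coords m)
    meet : ∃[ R ] ∃[ c ] coords R ≡ w ·ᵥ c → ∃[ R ] (R on ℓ × R on m)
    meet (R , c , R≡w·c) = R , incident ℓ (dot-cross-selfˡ (coords ℓ) (coords m))
                             , incident m (dot-cross-selfʳ (coords ℓ) (coords m))
      where
      incident : ∀ n → dot (coords n) w ≡ 0# → R on n
      incident n n·w≡0 = subst (λ r → dot (coords n) r ≡ 0#) (sym R≡w·c) (dot≡0-·ᵥ (coords n) w c n·w≡0)

  ∃-carrier? : ∀ {X : Carrier → Set} → Decidable X → Dec (∃ X)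
  ∃-carrier? {X} X? = map′ (λ (i , x) → Enum.from i , x)
    (λ (c , x) → Enum.to c , subst X (sym (Enum.strictlyInverseʳ c)) x)
    (any? (X? ∘ Enum.from))

  ∃-point? : ∀ {X : Point → Set} → Decidable X → Dec (∃ X)
  ∃-point? {X} X? = map′ from to
    (∃-carrier? (λ y → ∃-carrier? (X? ∘ pt1 y)) ⊎-dec (∃-carrier? (X? ∘ pt2) ⊎-dec X? pt3))
    where
    from : (∃[ y ] ∃[ z ] X (pt1 y z)) ⊎ (∃[ z ] X (pt2 z)) ⊎ X pt3 → ∃ X
    from (inj₁ (y , z , x))    = pt1 y z , x
    from (inj₂ (inj₁ (z , x))) = pt2 z , x
    from (inj₂ (inj₂ x))       = pt3 , x
    to : ∃ X → (∃[ y ] ∃[ z ] X (pt1 y z)) ⊎ (∃[ z ] X (pt2 z)) ⊎ X pt3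
    to (pt1 y z , x) = inj₁ (y , z , x)
    to (pt2 z , x)   = inj₂ (inj₁ (z , x))
    to (pt3 , x)     = inj₂ (inj₂ x)

  ¬∀⇒∃¬-point : ∀ {X : Point → Set} → Decidable X → ¬ (∀ P → X P) → ∃[ P ] ¬ X P
  ¬∀⇒∃¬-point X? ¬∀X with ∃-point? (¬? ∘ X?)
  ... | yes ∃¬X = ∃¬X
  ... | no ¬∃¬X = ⊥-elim (¬∀X λ P → decidable-stable (X? P) (¬∃¬X ∘ (P ,_)))

  _on?_ : ∀ P m → Dec (P on m)
  P on? m = dot (coords m) (coords P) ≟ 0#

  _∈?_ : ∀ P B → Dec (P ∈ B)
  P ∈? B = B P Bool.≟ true

  _∪｛_｝ : PointSet → Point → PointSet
  (A ∪｛ P ｝) Q = A Q ∨ does (Q ≟P P)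

  -- The sets are explicit arguments because membership unfolds to a Boolean expression in them.
  ∈-∖⁻ : ∀ B P {Q} → Q ∈ (B ∖｛ P ｝) → Q ∈ B × Q ≢ P
  ∈-∖⁻ B P {Q} Q∈ with Q ≟P P
  ... | no Q≢P = trans (sym (∧-identityʳ (B Q))) Q∈ , Q≢P
  ... | yes _ with trans (sym (∧-zeroʳ (B Q))) Q∈
  ...   | ()

  ∈-∖⁺ : ∀ B P {Q} → Q ∈ B → Q ≢ P → Q ∈ (B ∖｛ P ｝)
  ∈-∖⁺ B P {Q} Q∈B Q≢P with Q ≟P P
  ... | yes Q≡P = ⊥-elim (Q≢P Q≡P)
  ... | no _    = trans (∧-identityʳ (B Q)) Q∈B

  ∈-∪⁻ : ∀ A P {Q} → Q ∈ (A ∪｛ P ｝) → Q ∈ A ⊎ Q ≡ P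
  ∈-∪⁻ A P {Q} Q∈ with Q ≟P P
  ... | yes Q≡P = inj₂ Q≡P
  ... | no _    = inj₁ (trans (sym (∨-identityʳ (A Q))) Q∈)

  ∈-∪⁺ˡ : ∀ A P {Q} → Q ∈ A → Q ∈ (A ∪｛ P ｝)
  ∈-∪⁺ˡ A P {Q} Q∈A with Q ≟P P
  ... | yes _ = ∨-zeroʳ (A Q)
  ... | no _  = trans (∨-identityʳ (A Q)) Q∈A

  ∈-∪⁺ʳ : ∀ A P → P ∈ (A ∪｛ P ｝)
  ∈-∪⁺ʳ A P with P ≟P P
  ... | yes _   = ∨-zeroʳ (A P)
  ... | no P≢P = ⊥-elim (P≢P refl)

  ∖-injective : ∀ {B B′ P} → P ∈ B → P ∈ B′ → (B ∖｛ P ｝) ≐ (B′ ∖｛ P ｝) → B ≐ B′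
  ∖-injective {B} {B′} {P} P∈B P∈B′ B∖P≐B′∖P Q with Q ≟P P | B∖P≐B′∖P Q
  ... | yes refl | _  = trans P∈B (sym P∈B′)
  ... | no _     | eq = trans (sym (∧-identityʳ (B Q))) (trans eq (∧-identityʳ (B′ Q)))

  ∪-∖-inverse : ∀ {A P} → ¬ P ∈ A → ((A ∪｛ P ｝) ∖｛ P ｝) ≐ A
  ∪-∖-inverse {A} {P} P∉A Q with Q ≟P P
  ... | yes refl = trans (∧-zeroʳ _) (sym (¬-not P∉A))
  ... | no _     = trans (∧-identityʳ _) (∨-identityʳ (A Q))

  -- A record, unlike a Σ-type, keeps B, m and Q inferable: incidence and membership unfold.
  record TangentAt (B : PointSet) (m : Line) (Q : Point) : Set where
    constructor tangentAt
    field
      member   : Q ∈ B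
      incident : Q on m
      unique   : ∀ R → R ∈ B → R on m → R ≡ Q

  tangentAt⇒tangent : ∀ {B m Q} → TangentAt B m Q → Tangent B m
  tangentAt⇒tangent (tangentAt Q∈B Q∈m unique) = _ , (Q∈B , Q∈m) , unique

  tangent⇒tangentAt : ∀ {B m Q} → Tangent B m → Q ∈ B → Q on m → TangentAt B m Q
  tangent⇒tangentAt (_ , _ , unique) Q∈B Q∈m =
    tangentAt Q∈B Q∈m λ R R∈B R∈m → trans (unique R R∈B R∈m) (sym (unique _ Q∈B Q∈m))

  tangentAt-∖ : ∀ {B m P Q} → TangentAt B m Q → Q ≢ P → TangentAt (B ∖｛ P ｝) m Q
  tangentAt-∖ {B} {P = P} (tangentAt Q∈B Q∈m unique) Q≢P =
    tangentAt (∈-∖⁺ B P Q∈B Q≢P) Q∈m λ R R∈ R∈m → unique R (proj₁ (∈-∖⁻ B P R∈)) R∈m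

  secant⇒point≢ : ∀ {B m} → Secant B m → ∀ P → ∃[ R ] (R ∈ B × R on m × R ≢ P)
  secant⇒point≢ (Q , R , (Q∈B , Q∈m) , (R∈B , R∈m) , Q≢R) P with Q ≟P P
  ... | yes refl = R , R∈B , R∈m , Q≢R ∘ sym
  ... | no Q≢P   = Q , Q∈B , Q∈m , Q≢P

  tangents⇒no-blocking-proper-subset : ∀ {L : Line → Set} {B} →
    (∀ R → R ∈ B → ∃[ m ] (L m × TangentAt B m R)) →
    ∀ B′ → B′ ⊂ B → ¬ (∀ m → L m → ∃[ S ] (S ∈ B′ × S on m))
  tangents⇒no-blocking-proper-subset tangents B′ (B′⊆B , R , R∈B , R∉B′) blocks with tangents R R∈B
  ... | m , Lm , tangentAt _ _ unique with blocks m Lm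
  ...   | S , S∈B′ , S∈m = R∉B′ (subst (_∈ B′) (unique S (B′⊆B S S∈B′) S∈m) S∈B′)

  -- Opaque, so that type checking never unfolds the exhaustive search inside the proof.
  opaque
    minimal⇒tangentAt : ∀ {B Q} → IsMinimalBlockingSet B → Q ∈ B → ∃[ m ] TangentAt B m Q
    minimal⇒tangentAt {B} {Q} ((blocks , no-line) , minimal) Q∈B = m , tangentAt Q∈B Q∈m unique
      where
      B∖Q⊂B : (B ∖｛ Q ｝) ⊂ B
      B∖Q⊂B = (λ R → proj₁ ∘ ∈-∖⁻ B Q) , Q , Q∈B , (λ Q∈ → proj₂ (∈-∖⁻ B Q Q∈) refl)
      B∖Q-not-blocking : ¬ (∀ m → ∃[ R ] (R ∈ (B ∖｛ Q ｝) × R on m))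
      B∖Q-not-blocking blocks′ =
        minimal _ B∖Q⊂B (blocks′ , λ m m⊆ → no-line m (λ R → proj₁ ∘ ∈-∖⁻ B Q ∘ m⊆ R))
      missed : ∃[ m ] ¬ (∃[ R ] (R ∈ (B ∖｛ Q ｝) × R on m))
      missed = ¬∀⇒∃¬-point (λ m → ∃-point? (λ R → (R ∈? (B ∖｛ Q ｝)) ×-dec (R on? m))) B∖Q-not-blocking
      m : Line
      m = proj₁ missed
      unique : ∀ R → R ∈ B → R on m → R ≡ Q
      unique R R∈B R∈m with R ≟P Q
      ... | yes R≡Q = R≡Q
      ... | no R≢Q  = ⊥-elim (proj₂ missed (R , ∈-∖⁺ B Q R∈B R≢Q , R∈m))
      Q∈m : Q on m
      Q∈m with blocks m
      ... | R , R∈B , R∈m = subst (_on m) (unique R R∈B R∈m) R∈m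

  another-line : ∀ ℓ → ∃[ m ] m ≢ ℓ
  another-line ℓ with ℓ ≟P pt3
  ... | yes refl = pt2 0# , λ ()
  ... | no ℓ≢pt3 = pt3 , ℓ≢pt3 ∘ sym

  module Correspondence (ℓ : Line) (P : Point) (P∈ℓ : P on ℓ) where

    ∖-affine : ∀ {B} → TangentAt B ℓ P → IsAffineSet ℓ (B ∖｛ P ｝)
    ∖-affine {B} (tangentAt _ _ unique) Q Q∈ Q∈ℓ =
      let (Q∈B , Q≢P) = ∈-∖⁻ B P Q∈ in Q≢P (unique Q Q∈B Q∈ℓ)

    ∖-blocks : ∀ {B} → (∀ m → ∃[ Q ] (Q ∈ B × Q on m)) → (∀ m → P on m → m ≢ ℓ → Secant B m) →
               ∀ m → m ≢ ℓ → ∃[ Q ] (Q ∈ (B ∖｛ P ｝) × Q on m)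
    ∖-blocks {B} blocks secant m m≢ℓ with blocks m
    ... | Q , Q∈B , Q∈m with Q ≟P P
    ...   | no Q≢P = Q , ∈-∖⁺ B P Q∈B Q≢P , Q∈m
    ...   | yes refl =
      let (R , R∈B , R∈m , R≢P) = secant⇒point≢ {B} {m} (secant m Q∈m m≢ℓ) P
      in R , ∈-∖⁺ B P R∈B R≢P , R∈m

    ∖-tangentAt : ∀ {B Q} → IsMinimalBlockingSet B → TangentAt B ℓ P →
                  (∀ m → P on m → m ≢ ℓ → Secant B m) → Q ∈ (B ∖｛ P ｝) →
                  ∃[ m ] (m ≢ ℓ × ¬ P on m × TangentAt (B ∖｛ P ｝) m Q)
    ∖-tangentAt {B} {Q} minimal (tangentAt _ _ ℓ-unique) secant Q∈ =
      m , m≢ℓ , P∉m , tangentAt-∖ m-tangentAt Q≢P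
      where
      Q∈B : Q ∈ B
      Q∈B = proj₁ (∈-∖⁻ B P Q∈)
      Q≢P : Q ≢ P
      Q≢P = proj₂ (∈-∖⁻ B P Q∈)
      m : Line
      m = proj₁ (minimal⇒tangentAt minimal Q∈B)
      m-tangentAt : TangentAt B m Q
      m-tangentAt = proj₂ (minimal⇒tangentAt minimal Q∈B)
      m≢ℓ : m ≢ ℓ
      m≢ℓ m≡ℓ = Q≢P (ℓ-unique Q Q∈B (subst (Q on_) m≡ℓ (TangentAt.incident m-tangentAt)))
      P∉m : ¬ P on m
      P∉m P∈m =
        let (R , R∈B , R∈m , R≢Q) = secant⇒point≢ {B} {m} (secant m P∈m m≢ℓ) Q
        in R≢Q (TangentAt.unique m-tangentAt R R∈B R∈m)

    ∖-no-pencil-line : ∀ {B m} → P ∈ B → ¬ ContainsLine B m → m ≢ ℓ → P on m →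
                       ¬ AffContainsLine ℓ (B ∖｛ P ｝) m
    ∖-no-pencil-line {B} {m} P∈B m⊄B m≢ℓ P∈m m∖ℓ⊆B∖P = m⊄B m⊆B
      where
      m⊆B : ContainsLine B m
      m⊆B Q Q∈m with Q on? ℓ
      ... | yes Q∈ℓ = subst (_∈ B) (lines-meet-at-most-once {P = P} {Q} m≢ℓ P∈m P∈ℓ Q∈m Q∈ℓ) P∈B
      ... | no Q∉ℓ  = proj₁ (∈-∖⁻ B P (m∖ℓ⊆B∖P Q Q∈m Q∉ℓ))

    InX⇒InY : ∀ {B} → InX P ℓ B → InY ℓ P (B ∖｛ P ｝)
    InX⇒InY {B} (minimal@((blocks , no-line) , _) , P∈B , (_ , ℓ-tangent , secant)) =
      ((affine , affine-blocks) , irredundant) , (j , jj)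
      where
      ℓ-tangentAt : TangentAt B ℓ P
      ℓ-tangentAt = tangent⇒tangentAt ℓ-tangent P∈B P∈ℓ
      affine : IsAffineSet ℓ (B ∖｛ P ｝)
      affine = ∖-affine ℓ-tangentAt
      affine-blocks : ∀ m → m ≢ ℓ → ∃[ Q ] (Q ∈ (B ∖｛ P ｝) × Q on m × ¬ Q on ℓ)
      affine-blocks m m≢ℓ =
        let (Q , Q∈ , Q∈m) = ∖-blocks blocks secant m m≢ℓ in Q , Q∈ , Q∈m , affine Q Q∈
      tangents : ∀ Q → Q ∈ (B ∖｛ P ｝) → ∃[ m ] (m ≢ ℓ × ¬ P on m × TangentAt (B ∖｛ P ｝) m Q)
      tangents Q = ∖-tangentAt minimal ℓ-tangentAt secant
      irredundant : ∀ A′ → A′ ⊂ (B ∖｛ P ｝) → ¬ IsAffBlockingSet ℓ A′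
      irredundant A′ A′⊂A (_ , blocks′) = tangents⇒no-blocking-proper-subset {L = _≢ ℓ}
        (λ Q Q∈ → let (m , m≢ℓ , _ , m-tangentAt) = tangents Q Q∈ in m , m≢ℓ , m-tangentAt)
        A′ A′⊂A (λ m m≢ℓ → let (S , S∈A′ , S∈m , _) = blocks′ m m≢ℓ in S , S∈A′ , S∈m)
      j : ∀ Q → Q ∈ (B ∖｛ P ｝) → ∃[ m ] (m ≢ ℓ × ¬ (P on m) × Q on m × Tangent (B ∖｛ P ｝) m)
      j Q Q∈ = let (m , m≢ℓ , P∉m , m-tangentAt) = tangents Q Q∈
               in m , m≢ℓ , P∉m , TangentAt.incident m-tangentAt , tangentAt⇒tangent m-tangentAt
      jj : ∀ m → m ≢ ℓ → P on m → ¬ AffContainsLine ℓ (B ∖｛ P ｝) m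
      jj m = ∖-no-pencil-line P∈B (no-line m)

    ∪-tangentAt-ℓ : ∀ {A} → IsAffineSet ℓ A → TangentAt (A ∪｛ P ｝) ℓ P
    ∪-tangentAt-ℓ {A} affine = tangentAt (∈-∪⁺ʳ A P) P∈ℓ unique
      where
      unique : ∀ R → R ∈ (A ∪｛ P ｝) → R on ℓ → R ≡ P
      unique R R∈ R∈ℓ with ∈-∪⁻ A P R∈
      ... | inj₁ R∈A = ⊥-elim (affine R R∈A R∈ℓ)
      ... | inj₂ R≡P = R≡P

    ∪-tangentAt-off-pencil : ∀ {A m R} → Tangent A m → R ∈ A → R on m → ¬ P on m →
                             TangentAt (A ∪｛ P ｝) m R
    ∪-tangentAt-off-pencil {A} {m} {R} m-tangent R∈A R∈m P∉m = tangentAt (∈-∪⁺ˡ A P R∈A) R∈m unique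
      where
      unique : ∀ S → S ∈ (A ∪｛ P ｝) → S on m → S ≡ R
      unique S S∈ S∈m with ∈-∪⁻ A P S∈
      ... | inj₁ S∈A = TangentAt.unique (tangent⇒tangentAt {A} {m} {R} m-tangent R∈A R∈m) S S∈A S∈m
      ... | inj₂ refl = ⊥-elim (P∉m S∈m)

    ∪-blocks : ∀ {A} → (∀ m → m ≢ ℓ → ∃[ Q ] (Q ∈ A × Q on m × ¬ Q on ℓ)) →
               ∀ m → ∃[ Q ] (Q ∈ (A ∪｛ P ｝) × Q on m)
    ∪-blocks {A} blocks m with m ≟P ℓ
    ... | yes refl = P , ∈-∪⁺ʳ A P , P∈ℓ
    ... | no m≢ℓ with blocks m m≢ℓ
    ...   | Q , Q∈A , Q∈m , _ = Q , ∈-∪⁺ˡ A P Q∈A , Q∈m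

    ∪-secant : ∀ {A m} → (∀ m → m ≢ ℓ → ∃[ Q ] (Q ∈ A × Q on m × ¬ Q on ℓ)) →
               P on m → m ≢ ℓ → Secant (A ∪｛ P ｝) m
    ∪-secant {A} {m} blocks P∈m m≢ℓ with blocks m m≢ℓ
    ... | Q , Q∈A , Q∈m , Q∉ℓ =
      P , Q , (∈-∪⁺ʳ A P , P∈m) , (∈-∪⁺ˡ A P Q∈A , Q∈m) , λ P≡Q → Q∉ℓ (subst (_on ℓ) P≡Q P∈ℓ)

    m∩ℓ⊆B⇒P∈m : ∀ {B m} → TangentAt B ℓ P → m ≢ ℓ → (∀ R → R on m → R on ℓ → R ∈ B) → P on m
    m∩ℓ⊆B⇒P∈m {m = m} (tangentAt _ _ unique) m≢ℓ m∩ℓ⊆B =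
      let (R , R∈m , R∈ℓ) = distinct-lines-meet m≢ℓ
      in subst (_on m) (unique R (m∩ℓ⊆B R R∈m R∈ℓ) R∈ℓ) R∈m

    ∪-no-line : ∀ {A} → InY ℓ P A → ∀ m → ¬ ContainsLine (A ∪｛ P ｝) m
    ∪-no-line {A} (((affine , blocks) , _) , (tangents , no-pencil-line)) m m⊆B with m ≟P ℓ
    ... | yes refl =
      let (n , n≢ℓ)           = another-line ℓ
          (Q , Q∈A , _)       = blocks n n≢ℓ
          (t , t≢ℓ , P∉t , _) = tangents Q Q∈A
      in P∉t (m∩ℓ⊆B⇒P∈m (∪-tangentAt-ℓ affine) t≢ℓ (λ R _ R∈ℓ → m⊆B R R∈ℓ))
    ... | no m≢ℓ with P on? m
    ...   | no P∉m  = P∉m (m∩ℓ⊆B⇒P∈m (∪-tangentAt-ℓ affine) m≢ℓ (λ R R∈m _ → m⊆B R R∈m))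
    ...   | yes P∈m = no-pencil-line m m≢ℓ P∈m m∖ℓ⊆A
      where
      m∖ℓ⊆A : AffContainsLine ℓ A m
      m∖ℓ⊆A Q Q∈m Q∉ℓ with ∈-∪⁻ A P (m⊆B Q Q∈m)
      ... | inj₁ Q∈A  = Q∈A
      ... | inj₂ refl = ⊥-elim (Q∉ℓ P∈ℓ)

    InY⇒P∉ : ∀ {A} → InY ℓ P A → ¬ P ∈ A
    InY⇒P∉ (((affine , _) , _) , _) P∈A = affine P P∈A P∈ℓ

    InY⇒InX : ∀ {A} → InY ℓ P A → InX P ℓ (A ∪｛ P ｝)
    InY⇒InX {A} A∈Y@(((affine , blocks) , _) , (tangents , _)) =
      ((∪-blocks blocks , ∪-no-line A∈Y) , minimal) , ∈-∪⁺ʳ A P ,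
      (P∈ℓ , tangentAt⇒tangent (∪-tangentAt-ℓ affine) , λ m P∈m m≢ℓ → ∪-secant blocks P∈m m≢ℓ)
      where
      tangentAt-everywhere : ∀ R → R ∈ (A ∪｛ P ｝) → ∃[ m ] (⊤ × TangentAt (A ∪｛ P ｝) m R)
      tangentAt-everywhere R R∈ with ∈-∪⁻ A P R∈
      ... | inj₂ refl = ℓ , tt , ∪-tangentAt-ℓ affine
      ... | inj₁ R∈A with tangents R R∈A
      ...   | m , _ , P∉m , R∈m , m-tangent = m , tt , ∪-tangentAt-off-pencil m-tangent R∈A R∈m P∉m
      minimal : ∀ B′ → B′ ⊂ (A ∪｛ P ｝) → ¬ IsBlockingSet B′
      minimal B′ B′⊂B (blocks′ , _) =
        tangents⇒no-blocking-proper-subset tangentAt-everywhere B′ B′⊂B (λ m _ → blocks′ m)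

proposition4p11 : (q : ℕ) → IsPrimePower q → (𝔽 : FiniteField q) →
    let open PG 𝔽 in
    (ℓ : Line) (P : Point) → P on ℓ →
    -- α is well defined: α(𝒳_{P,ℓ}) ⊆ 𝒴_{Π_P}
    (∀ B → InX P ℓ B → InY ℓ P (B ∖｛ P ｝))
    -- α is injective on 𝒳_{P,ℓ}
    × (∀ B B' → InX P ℓ B → InX P ℓ B' → (B ∖｛ P ｝) ≐ (B' ∖｛ P ｝) → B ≐ B')
    -- α is surjective onto 𝒴_{Π_P}
    × (∀ A → InY ℓ P A → ∃[ B ] (InX P ℓ B × (B ∖｛ P ｝) ≐ A))
proposition4p11 q _ 𝔽 ℓ P P∈ℓ =
    (λ B → InX⇒InY)
  , (λ B B′ (_ , P∈B , _) (_ , P∈B′ , _) → ∖-injective P∈B P∈B′)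
  , λ A A∈Y → A ∪｛ P ｝ , InY⇒InX A∈Y , ∪-∖-inverse (InY⇒P∉ A∈Y)
  where
  open PlaneGeometry 𝔽
  open Correspondence ℓ P P∈ℓ
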